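{- For every integer $k\ge 1$ let $d_k(n)$ be defined by $\sum_{n=0}^\infty d_k(n)q^n=\dfrac{f_2^k}{f_1^{3k+1}}$, where $f_m:=\prod_{i=1}^\infty(1-q^{mi})$. Let $p$ be a prime and let $k\ge1$, $j\ge0$, $N\ge1$, $M\ge1$ and $r$ be integers with $1\le r\le p^M-1$. If $d_k(p^Mn+r)\equiv 0\pmod{p^N}$ for all integers $n\ge0$, then $d_{p^{M+N-1}j+k}(p^Mn+r)\equiv 0\pmod{p^N}$ for all integers $n\ge 0$.
   Context: Here $|q|<1$ and $f_m:=(q^m;q^m)_\infty=\prod_{i=1}^\infty(1-q^{mi})$. The number $d_k(n)$ counts the partitions obtained by adding the links of the $k$-elongated plane partition diamonds of length $n$; all that is needed is its generating function $\sum_{n\ge0}d_k(n)q^n=f_2^k/f_1^{3k+1}$. -}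

module Defs where

open import Data.Nat using (ℕ; zero; suc; _∸_)
open import Data.Nat.Divisibility using (_∣?_)
open import Data.Integer using (ℤ; +_; _+_; _*_; _-_)
open import Data.Bool using (if_then_else_)
open import Relation.Nullary.Decidable using (⌊_⌋)

Series : Set
Series = ℕ → ℤ

sumTo : (ℕ → ℤ) → ℕ → ℤ
sumTo a zero    = a zero
sumTo a (suc n) = sumTo a n + a (suc n)

oneS : Series
oneS zero    = + 1
oneS (suc _) = + 0

mulS : Series → Series → Series
mulS a b n = sumTo (λ i → a i * b (n ∸ i)) n

powS : Series → ℕ → Series
powS a zero    = oneS
powS a (suc k) = mulS a (powS a k)

prodTo : (ℕ → Series) → ℕ → Series
prodTo F zero    = oneS
prodTo F (suc N) = mulS (prodTo F N) (F (suc N))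

-- coefficientwise infinite product ∏_{i≥1} F i, valid when F i ≡ 1 mod q^{i}
-- (each factor with i > n does not affect the coefficient of q^n)
prodInf : (ℕ → Series) → Series
prodInf F n = prodTo F n n

oneMinusQ : ℕ → Series
oneMinusQ e n = oneS n - (if ⌊ e Data.Nat.≟ n ⌋ then + 1 else + 0)

-- 1/(1 - q^e) = Σ_{t≥0} q^{e t}  (for e ≥ 1)
geomQ : ℕ → Series
geomQ e n = if ⌊ e ∣? n ⌋ then + 1 else + 0

f : ℕ → Series
f m = prodInf (λ i → oneMinusQ (m Data.Nat.* i))

f1inv : Series
f1inv = prodInf geomQ

d : ℕ → ℕ → ℤ
d k = mulS (powS (f 2) k) (powS f1inv (suc (3 Data.Nat.* k)))

{-# OPTIONS --safe #-}
module Submission where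

-- Since Σ d_{A+k}(n) qⁿ = (Σ d_k(n) qⁿ)·Gᴬ with G = f₂/f₁³, it suffices that G^{p^{M+N-1}} is
-- congruent modulo p^N to a series in q^{p^M}: multiplying by such a series only combines
-- coefficients whose indices agree modulo p^M. By Frobenius,
-- (X + Y)ᵖ ≡ Xᵖ + Yᵖ (mod p), the p-th power of a series in q^{pᵉ} is congruent mod p to a series
-- in q^{pᵉ⁺¹}; and X ≡ Y (mod p^{s+1}) implies Xᵖ ≡ Yᵖ (mod p^{s+2}). Alternating the two gives
-- G^{p^{M+s}} ≡ W^{p^s} (mod p^{s+1}) for a series W in q^{p^M}.

open import Defs

module _ where
  open import Level using (0ℓ)
  open import Function using (_∘_)
  open import Data.Nat as ℕ using (ℕ; zero; suc; _∸_; _≤_; _<_; z≤n; s≤s; NonZero)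
  import Data.Nat.Properties as ℕₚ
  open import Data.Nat.Induction using (<-rec)
  open import Data.Nat.DivMod using (_/_; _%_; m≡m%n+[m/n]*n; [m+kn]%n≡m%n; m<n⇒m%n≡m)
  open import Data.Nat.Divisibility as ℕᵈ using () renaming (_∣_ to _∣ℕ_)
  open import Data.Nat.Primality using (Prime; euclidsLemma; prime⇒nonZero)
  open import Data.Nat.Combinatorics using (_C_; nCn≡1; nC1≡n; nCk+nC[k+1]≡[n+1]C[k+1])
  open import Data.Fin using (zero; suc; fromℕ; inject₁; toℕ)
  import Data.Fin.Properties as Finₚ
  open import Data.Integer using (ℤ; +_; _+_; _*_; _-_; -_)
  import Data.Integer.Properties as ℤₚ
  open import Data.Integer.Divisibility.Signed
    using (_∣_; divides; ∣-refl; ∣-trans; ∣m∣n⇒∣m+n; ∣m⇒∣-m; ∣m⇒∣m*n; ∣n⇒∣m*n; ∣ᵤ⇒∣; *-monoʳ-∣; *-monoˡ-∣)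
  open import Data.Product using (_,_; ∃-syntax)
  open import Data.Sum using (inj₁; inj₂)
  open import Algebra.Bundles using (CommutativeRing)
  open import Algebra.Structures using (IsCommutativeRing)
  open import Relation.Nullary using (¬_; yes; no; contradiction)
  open import Relation.Binary.PropositionalEquality hiding (setoid)

  ∣0 : ∀ {m : ℤ} → m ∣ + 0
  ∣0 {m} = divides (+ 0) (sym (ℤₚ.*-zeroˡ m))

  module _ where
    open import Data.Integer.Solver using (module +-*-Solver)
    open +-*-Solver

    [a+b]+[c+d]≡[a+c]+[b+d] : ∀ a b c d → (a + b) + (c + d) ≡ (a + c) + (b + d)
    [a+b]+[c+d]≡[a+c]+[b+d] = solve 4 (λ a b c d → (a :+ b) :+ (c :+ d) := (a :+ c) :+ (b :+ d)) refl

    [a-b]+[c-d]≡[a+c]-[b+d] : ∀ a b c d → (a - b) + (c - d) ≡ (a + c) - (b + d)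
    [a-b]+[c-d]≡[a+c]-[b+d] = solve 4 (λ a b c d → (a :- b) :+ (c :- d) := (a :+ c) :- (b :+ d)) refl

    [a-b]+[b-c]≡a-c : ∀ a b c → (a - b) + (b - c) ≡ a - c
    [a-b]+[b-c]≡a-c = solve 3 (λ a b c → (a :- b) :+ (b :- c) := a :- c) refl

    [a-b]+b≡a : ∀ a b → (a - b) + b ≡ a
    [a-b]+b≡a = solve 2 (λ a b → (a :- b) :+ b := a) refl

    a≡b+[a-b] : ∀ a b → a ≡ b + (a - b)
    a≡b+[a-b] = solve 2 (λ a b → a := b :+ (a :- b)) refl

    -[a-b]≡b-a : ∀ a b → - (a - b) ≡ b - a
    -[a-b]≡b-a = solve 2 (λ a b → :- (a :- b) := b :- a) refl

    -[a-b]≡[-a]-[-b] : ∀ a b → - (a - b) ≡ (- a) - (- b)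
    -[a-b]≡[-a]-[-b] = solve 2 (λ a b → :- (a :- b) := (:- a) :- (:- b)) refl

    [a-a′]b+a′[b-b′]≡ab-a′b′ : ∀ a a′ b b′ → (a - a′) * b + a′ * (b - b′) ≡ a * b - a′ * b′
    [a-a′]b+a′[b-b′]≡ab-a′b′ =
      solve 4 (λ a a′ b b′ → (a :- a′) :* b :+ a′ :* (b :- b′) := a :* b :- a′ :* b′) refl

    ab·c+[a·d+e]≡a[bc+d]+e : ∀ a b c d e → (a * b) * c + (a * d + e) ≡ a * (b * c + d) + e
    ab·c+[a·d+e]≡a[bc+d]+e =
      solve 5 (λ a b c d e → (a :* b) :* c :+ (a :* d :+ e) := a :* (b :* c :+ d) :+ e) refl

  sumTo-cong : ∀ {g h : ℕ → ℤ} n → (∀ i → i ≤ n → g i ≡ h i) → sumTo g n ≡ sumTo h n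
  sumTo-cong zero    g≡h = g≡h 0 z≤n
  sumTo-cong (suc n) g≡h =
    cong₂ _+_ (sumTo-cong n (λ i i≤n → g≡h i (ℕₚ.m≤n⇒m≤1+n i≤n))) (g≡h (suc n) ℕₚ.≤-refl)

  sumTo-zero : ∀ {g : ℕ → ℤ} n → (∀ i → i ≤ n → g i ≡ + 0) → sumTo g n ≡ + 0
  sumTo-zero zero    g≡0 = g≡0 0 z≤n
  sumTo-zero (suc n) g≡0 =
    cong₂ _+_ (sumTo-zero n (λ i i≤n → g≡0 i (ℕₚ.m≤n⇒m≤1+n i≤n))) (g≡0 (suc n) ℕₚ.≤-refl)

  ∣-sumTo : ∀ {m : ℤ} {g : ℕ → ℤ} n → (∀ i → i ≤ n → m ∣ g i) → m ∣ sumTo g n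
  ∣-sumTo zero    m∣g = m∣g 0 z≤n
  ∣-sumTo (suc n) m∣g =
    ∣m∣n⇒∣m+n (∣-sumTo n (λ i i≤n → m∣g i (ℕₚ.m≤n⇒m≤1+n i≤n))) (m∣g (suc n) ℕₚ.≤-refl)

  sumTo-head : ∀ (g : ℕ → ℤ) n → sumTo g (suc n) ≡ g 0 + sumTo (g ∘ suc) n
  sumTo-head g zero    = refl
  sumTo-head g (suc n) =
    trans (cong (_+ g (suc (suc n))) (sumTo-head g n)) (ℤₚ.+-assoc (g 0) _ _)

  sumTo-reverse : ∀ (g : ℕ → ℤ) n → sumTo g n ≡ sumTo (λ i → g (n ∸ i)) n
  sumTo-reverse g zero    = refl
  sumTo-reverse g (suc n) = begin
    sumTo g n + g (suc n)                      ≡⟨ cong (_+ g (suc n)) (sumTo-reverse g n) ⟩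
    sumTo (λ i → g (n ∸ i)) n + g (suc n)      ≡⟨ ℤₚ.+-comm _ (g (suc n)) ⟩
    g (suc n) + sumTo (λ i → g (n ∸ i)) n      ≡⟨ sumTo-head (λ i → g (suc n ∸ i)) n ⟨
    sumTo (λ i → g (suc n ∸ i)) (suc n)        ∎
    where open ≡-Reasoning

  sumTo-+ : ∀ (g h : ℕ → ℤ) n → sumTo (λ i → g i + h i) n ≡ sumTo g n + sumTo h n
  sumTo-+ g h zero    = refl
  sumTo-+ g h (suc n) = trans (cong (_+ (g (suc n) + h (suc n))) (sumTo-+ g h n))
    ([a+b]+[c+d]≡[a+c]+[b+d] (sumTo g n) (sumTo h n) (g (suc n)) (h (suc n)))

  sumTo-- : ∀ (g h : ℕ → ℤ) n → sumTo (λ i → g i - h i) n ≡ sumTo g n - sumTo h n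
  sumTo-- g h zero    = refl
  sumTo-- g h (suc n) = trans (cong (_+ (g (suc n) - h (suc n))) (sumTo-- g h n))
    ([a-b]+[c-d]≡[a+c]-[b+d] (sumTo g n) (sumTo h n) (g (suc n)) (h (suc n)))

  *-distribˡ-sumTo : ∀ (s : ℤ) (g : ℕ → ℤ) n → s * sumTo g n ≡ sumTo (λ i → s * g i) n
  *-distribˡ-sumTo s g zero    = refl
  *-distribˡ-sumTo s g (suc n) =
    trans (ℤₚ.*-distribˡ-+ s (sumTo g n) (g (suc n))) (cong (_+ s * g (suc n)) (*-distribˡ-sumTo s g n))

  addS : Series → Series → Series
  addS a b n = a n + b n

  negS : Series → Series
  negS a n = - a n

  zeroS : Series
  zeroS _ = + 0

  scaleS : ℤ → Series → Series
  scaleS s a n = s * a n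

  mulS-cong : ∀ {a a′ b b′} → a ≗ a′ → b ≗ b′ → mulS a b ≗ mulS a′ b′
  mulS-cong a≗a′ b≗b′ n = sumTo-cong n (λ i _ → cong₂ _*_ (a≗a′ i) (b≗b′ (n ∸ i)))

  mulS-suc : ∀ a b n → mulS a b (suc n) ≡ a 0 * b (suc n) + mulS (a ∘ suc) b n
  mulS-suc a b n = sumTo-head _ n

  mulS-comm : ∀ a b → mulS a b ≗ mulS b a
  mulS-comm a b n = trans (sumTo-reverse _ n) (sumTo-cong n λ i i≤n →
    trans (cong (λ j → a (n ∸ i) * b j) (ℕₚ.m∸[m∸n]≡n i≤n)) (ℤₚ.*-comm (a (n ∸ i)) (b i)))

  mulS-distribˡ : ∀ a b c → mulS a (addS b c) ≗ addS (mulS a b) (mulS a c)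
  mulS-distribˡ a b c n =
    trans (sumTo-cong n (λ i _ → ℤₚ.*-distribˡ-+ (a i) (b (n ∸ i)) (c (n ∸ i)))) (sumTo-+ _ _ n)

  mulS-distribʳ : ∀ a b c → mulS (addS b c) a ≗ addS (mulS b a) (mulS c a)
  mulS-distribʳ a b c n = trans (mulS-comm (addS b c) a n)
    (trans (mulS-distribˡ a b c n) (cong₂ _+_ (mulS-comm a b n) (mulS-comm a c n)))

  mulS-scaleˡ : ∀ s b c → mulS (scaleS s b) c ≗ scaleS s (mulS b c)
  mulS-scaleˡ s b c n =
    trans (sumTo-cong n (λ i _ → ℤₚ.*-assoc s (b i) (c (n ∸ i)))) (sym (*-distribˡ-sumTo s _ n))

  mulS-identityˡ : ∀ a → mulS oneS a ≗ a
  mulS-identityˡ a zero    = ℤₚ.*-identityˡ (a 0)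
  mulS-identityˡ a (suc n) = begin
    mulS oneS a (suc n)                       ≡⟨ mulS-suc oneS a n ⟩
    + 1 * a (suc n) + mulS (oneS ∘ suc) a n   ≡⟨ cong (_+_ (+ 1 * a (suc n))) higher-terms-vanish ⟩
    + 1 * a (suc n) + + 0                     ≡⟨ ℤₚ.+-identityʳ _ ⟩
    + 1 * a (suc n)                           ≡⟨ ℤₚ.*-identityˡ (a (suc n)) ⟩
    a (suc n)                                 ∎
    where
    open ≡-Reasoning
    higher-terms-vanish : mulS (oneS ∘ suc) a n ≡ + 0
    higher-terms-vanish = sumTo-zero n (λ i _ → ℤₚ.*-zeroˡ (a (n ∸ i)))

  mulS-identityʳ : ∀ a → mulS a oneS ≗ a
  mulS-identityʳ a n = trans (mulS-comm a oneS n) (mulS-identityˡ a n)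

  mulS-assoc : ∀ a b c n → mulS (mulS a b) c n ≡ mulS a (mulS b c) n
  mulS-assoc a b c zero    = ℤₚ.*-assoc (a 0) (b 0) (c 0)
  mulS-assoc a b c (suc n) = begin
    mulS (mulS a b) c (suc n)
      ≡⟨ mulS-suc (mulS a b) c n ⟩
    a₀b₀ * c (suc n) + mulS (mulS a b ∘ suc) c n
      ≡⟨ cong (_+_ (a₀b₀ * c (suc n))) (trans (mulS-cong {b = c} (mulS-suc a b) (λ _ → refl) n)
                                           (mulS-distribʳ c (scaleS (a 0) (b ∘ suc)) (mulS (a ∘ suc) b) n)) ⟩
    a₀b₀ * c (suc n) + (mulS (scaleS (a 0) (b ∘ suc)) c n + mulS (mulS (a ∘ suc) b) c n)
      ≡⟨ cong₂ (λ u v → a₀b₀ * c (suc n) + (u + v))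
               (mulS-scaleˡ (a 0) (b ∘ suc) c n) (mulS-assoc (a ∘ suc) b c n) ⟩
    a₀b₀ * c (suc n) + (a 0 * mulS (b ∘ suc) c n + mulS (a ∘ suc) (mulS b c) n)
      ≡⟨ ab·c+[a·d+e]≡a[bc+d]+e (a 0) (b 0) (c (suc n)) (mulS (b ∘ suc) c n) (mulS (a ∘ suc) (mulS b c) n) ⟩
    a 0 * (b 0 * c (suc n) + mulS (b ∘ suc) c n) + mulS (a ∘ suc) (mulS b c) n
      ≡⟨ cong (λ z → a 0 * z + mulS (a ∘ suc) (mulS b c) n) (mulS-suc b c n) ⟨
    a 0 * mulS b c (suc n) + mulS (a ∘ suc) (mulS b c) n
      ≡⟨ mulS-suc a (mulS b c) n ⟨
    mulS a (mulS b c) (suc n)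
      ∎
    where
    open ≡-Reasoning
    a₀b₀ = a 0 * b 0

  -- Congruences of power series

  infix 4 _≈_mod_
  record _≈_mod_ (a b : Series) (m : ℤ) : Set where
    constructor coeffwise
    field coeff-∣ : ∀ n → m ∣ a n - b n
  open _≈_mod_ public

  ≗⇒≈ : ∀ {m a b} → a ≗ b → a ≈ b mod m
  ≗⇒≈ {b = b} a≗b = coeffwise λ n →
    subst (_ ∣_) (sym (trans (cong (_- b n) (a≗b n)) (ℤₚ.+-inverseʳ (b n)))) ∣0

  ≈-weaken : ∀ {m m′ a b} → m ∣ m′ → a ≈ b mod m′ → a ≈ b mod m
  ≈-weaken m∣m′ a≈b = coeffwise λ n → ∣-trans m∣m′ (coeff-∣ a≈b n)

  ≈-coeff-∣ : ∀ {m a b} → a ≈ b mod m → ∀ n → m ∣ b n → m ∣ a n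
  ≈-coeff-∣ {a = a} {b} a≈b n m∣b = subst (_ ∣_) ([a-b]+b≡a (a n) (b n))
    (∣m∣n⇒∣m+n (coeff-∣ a≈b n) m∣b)

  ∣⇒≈0 : ∀ {m a} → (∀ n → m ∣ a n) → a ≈ zeroS mod m
  ∣⇒≈0 m∣a = coeffwise λ n → subst (_ ∣_) (sym (ℤₚ.+-identityʳ _)) (m∣a n)

  ≈0⇒∣ : ∀ {m a} → a ≈ zeroS mod m → ∀ n → m ∣ a n
  ≈0⇒∣ a≈0 n = subst (_ ∣_) (ℤₚ.+-identityʳ _) (coeff-∣ a≈0 n)

  module _ {m : ℤ} where

    ≈-refl : ∀ {a} → a ≈ a mod m
    ≈-refl = ≗⇒≈ (λ _ → refl)

    ≈-sym : ∀ {a b} → a ≈ b mod m → b ≈ a mod m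
    ≈-sym {a} {b} a≈b = coeffwise λ n →
      subst (_ ∣_) (-[a-b]≡b-a (a n) (b n)) (∣m⇒∣-m (coeff-∣ a≈b n))

    ≈-trans : ∀ {a b c} → a ≈ b mod m → b ≈ c mod m → a ≈ c mod m
    ≈-trans {a} {b} {c} a≈b b≈c = coeffwise λ n →
      subst (_ ∣_) ([a-b]+[b-c]≡a-c (a n) (b n) (c n))
        (∣m∣n⇒∣m+n (coeff-∣ a≈b n) (coeff-∣ b≈c n))

    addS-cong : ∀ {a a′ b b′} → a ≈ a′ mod m → b ≈ b′ mod m → addS a b ≈ addS a′ b′ mod m
    addS-cong {a} {a′} {b} {b′} a≈a′ b≈b′ = coeffwise λ n →
      subst (_ ∣_) ([a-b]+[c-d]≡[a+c]-[b+d] (a n) (a′ n) (b n) (b′ n))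
        (∣m∣n⇒∣m+n (coeff-∣ a≈a′ n) (coeff-∣ b≈b′ n))

    negS-cong : ∀ {a a′} → a ≈ a′ mod m → negS a ≈ negS a′ mod m
    negS-cong {a} {a′} a≈a′ = coeffwise λ n →
      subst (_ ∣_) (-[a-b]≡[-a]-[-b] (a n) (a′ n)) (∣m⇒∣-m (coeff-∣ a≈a′ n))

    mulS-cong-≈ : ∀ {a a′ b b′} → a ≈ a′ mod m → b ≈ b′ mod m → mulS a b ≈ mulS a′ b′ mod m
    mulS-cong-≈ {a} {a′} {b} {b′} a≈a′ b≈b′ = coeffwise λ n →
      subst (_ ∣_) (sumTo-- _ _ n) (∣-sumTo n λ i _ →
        subst (_ ∣_) ([a-a′]b+a′[b-b′]≡ab-a′b′ (a i) (a′ i) (b (n ∸ i)) (b′ (n ∸ i)))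
          (∣m∣n⇒∣m+n (∣m⇒∣m*n (b (n ∸ i)) (coeff-∣ a≈a′ i)) (∣n⇒∣m*n (a′ i) (coeff-∣ b≈b′ (n ∸ i)))))

    isCommutativeRing : IsCommutativeRing (_≈_mod m) addS mulS negS zeroS oneS
    isCommutativeRing = record
      { isRing = record
        { +-isAbelianGroup = record
          { isGroup = record
            { isMonoid = record
              { isSemigroup = record
                { isMagma = record
                  { isEquivalence = record { refl = ≈-refl ; sym = ≈-sym ; trans = ≈-trans }
                  ; ∙-cong = addS-cong }
                ; assoc = λ a b c → ≗⇒≈ (λ n → ℤₚ.+-assoc (a n) (b n) (c n)) }
              ; identity = (λ a → ≗⇒≈ (λ n → ℤₚ.+-identityˡ (a n)))
                         , (λ a → ≗⇒≈ (λ n → ℤₚ.+-identityʳ (a n))) }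
            ; inverse = (λ a → ≗⇒≈ (λ n → ℤₚ.+-inverseˡ (a n))) , (λ a → ≗⇒≈ (λ n → ℤₚ.+-inverseʳ (a n)))
            ; ⁻¹-cong = negS-cong }
          ; comm = λ a b → ≗⇒≈ (λ n → ℤₚ.+-comm (a n) (b n)) }
        ; *-cong = mulS-cong-≈
        ; *-assoc = λ a b c → ≗⇒≈ (mulS-assoc a b c)
        ; *-identity = (λ a → ≗⇒≈ (mulS-identityˡ a)) , (λ a → ≗⇒≈ (mulS-identityʳ a))
        ; distrib = (λ a b c → ≗⇒≈ (mulS-distribˡ a b c)) , (λ a b c → ≗⇒≈ (mulS-distribʳ a b c)) }
      ; *-comm = λ a b → ≗⇒≈ (mulS-comm a b) }

  seriesRing : ℤ → CommutativeRing 0ℓ 0ℓ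
  seriesRing m = record { isCommutativeRing = isCommutativeRing {m} }

  module _ {m : ℤ} where
    open CommutativeRing (seriesRing m) using (semiring; commutativeSemiring)
    open import Algebra.Properties.Semiring.Exp semiring using (_^_; ^-congˡ; ^-homo-*; ^-assocʳ)
    open import Algebra.Properties.CommutativeSemiring.Exp commutativeSemiring using (^-distrib-*)

    powS-≡-^ : ∀ a n → powS a n ≡ a ^ n
    powS-≡-^ a zero    = refl
    powS-≡-^ a (suc n) = cong (mulS a) (powS-≡-^ a n)

    powS≈^ : ∀ a n → powS a n ≈ a ^ n mod m
    powS≈^ a n = ≗⇒≈ (λ k → cong (λ s → s k) (powS-≡-^ a n))

    powS-cong : ∀ {a b} n → a ≈ b mod m → powS a n ≈ powS b n mod m
    powS-cong {a} {b} n a≈b =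
      ≈-trans (powS≈^ a n) (≈-trans (^-congˡ n a≈b) (≈-sym (powS≈^ b n)))

    powS-+ : ∀ a i j → powS a (i ℕ.+ j) ≈ mulS (powS a i) (powS a j) mod m
    powS-+ a i j = ≈-trans (powS≈^ a (i ℕ.+ j))
      (≈-trans (^-homo-* a i j) (≈-sym (mulS-cong-≈ (powS≈^ a i) (powS≈^ a j))))

    powS-* : ∀ a i j → powS (powS a i) j ≈ powS a (i ℕ.* j) mod m
    powS-* a i j = ≈-trans (powS≈^ (powS a i) j) (≈-trans (^-congˡ j (powS≈^ a i))
      (≈-trans (^-assocʳ a i j) (≈-sym (powS≈^ a (i ℕ.* j)))))

    powS-distrib : ∀ a b n → powS (mulS a b) n ≈ mulS (powS a n) (powS b n) mod m
    powS-distrib a b n = ≈-trans (powS≈^ (mulS a b) n)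
      (≈-trans (^-distrib-* a b n) (≈-sym (mulS-cong-≈ (powS≈^ a n) (powS≈^ b n))))

  -- Lifting congruences to p-th powers

  mulS-∣ : ∀ {u v : ℤ} a b → (∀ n → u ∣ a n) → (∀ n → v ∣ b n) → ∀ n → u * v ∣ mulS a b n
  mulS-∣ {u} {v} a b u∣a v∣b n = ∣-sumTo n λ i _ →
    ∣-trans (*-monoʳ-∣ u (v∣b (n ∸ i))) (*-monoˡ-∣ (b (n ∸ i)) (u∣a i))

  geometricSum : Series → Series → ℕ → Series
  geometricSum X Y zero    = zeroS
  geometricSum X Y (suc n) = addS (mulS X (geometricSum X Y n)) (powS Y n)

  module _ {m : ℤ} where
    open CommutativeRing (seriesRing m)
      using (setoid; semiring; commutativeSemiring; +-congˡ; +-congʳ; *-congˡ; *-congʳ; +-comm; zeroʳ)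
    open import Algebra.Properties.Semiring.Mult semiring using (_×_; ×-comm-*)
    open import Relation.Binary.Reasoning.Setoid setoid

    ×-vanishes : ∀ N a → m ∣ + N → N × a ≈ zeroS mod m
    ×-vanishes N a m∣N = ∣⇒≈0 λ k → subst (m ∣_) (sym (×-coeff N k)) (∣m⇒∣m*n (a k) m∣N)
      where
      ×-coeff : ∀ n k → (n × a) k ≡ + n * a k
      ×-coeff zero    k = sym (ℤₚ.*-zeroˡ (a k))
      ×-coeff (suc n) k = trans (cong (_+_ (a k)) (×-coeff n k))
        (sym (trans (ℤₚ.*-distribʳ-+ (a k) (+ 1) (+ n)) (cong (λ z → z + + n * a k) (ℤₚ.*-identityˡ (a k)))))

    powS-difference : ∀ X Y n →
      powS X n ≈ addS (powS Y n) (mulS (addS X (negS Y)) (geometricSum X Y n)) mod m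
    powS-difference X Y zero    = ≗⇒≈ λ k → sym (trans
      (cong (_+_ (oneS k)) (sumTo-zero k (λ i _ → ℤₚ.*-zeroʳ (X i - Y i)))) (ℤₚ.+-identityʳ (oneS k)))
    powS-difference X Y (suc n) = begin
      mulS X (powS X n)
        ≈⟨ *-congˡ {X} (powS-difference X Y n) ⟩
      mulS X (addS Yⁿ (mulS D Sₙ))
        ≈⟨ *-congʳ {addS Yⁿ (mulS D Sₙ)} X≈Y+D ⟩
      mulS (addS Y D) (addS Yⁿ (mulS D Sₙ))
        ≈⟨ solve 4 (λ y d yⁿ s → (y :+ d) :* (yⁿ :+ d :* s) := y :* yⁿ :+ d :* ((y :+ d) :* s :+ yⁿ))
                 ≈-refl Y D Yⁿ Sₙ ⟩
      addS (mulS Y Yⁿ) (mulS D (addS (mulS (addS Y D) Sₙ) Yⁿ))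
        ≈⟨ +-congˡ {mulS Y Yⁿ} (*-congˡ {D} (+-congʳ {Yⁿ} (*-congʳ {Sₙ} (≈-sym X≈Y+D)))) ⟩
      addS (mulS Y Yⁿ) (mulS D (addS (mulS X Sₙ) Yⁿ))
        ∎
      where
      open import Algebra.Solver.Ring.NaturalCoefficients.Default commutativeSemiring
      D = addS X (negS Y)
      Yⁿ = powS Y n
      Sₙ = geometricSum X Y n
      X≈Y+D : X ≈ addS Y D mod m
      X≈Y+D = ≗⇒≈ λ k → a≡b+[a-b] (X k) (Y k)

    geometricSum-cong : ∀ {X X′} Y n → X ≈ X′ mod m → geometricSum X Y n ≈ geometricSum X′ Y n mod m
    geometricSum-cong Y zero    X≈X′ = ≈-refl
    geometricSum-cong Y (suc n) X≈X′ = +-congʳ {powS Y n} (mulS-cong-≈ X≈X′ (geometricSum-cong Y n X≈X′))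

    geometricSum-diagonal : ∀ Y n → geometricSum Y Y n ≈ n × powS Y (n ∸ 1) mod m
    geometricSum-diagonal Y zero          = ≈-refl
    geometricSum-diagonal Y (suc zero)    = ≈-trans (+-congʳ {oneS} (zeroʳ Y)) (+-comm zeroS oneS)
    geometricSum-diagonal Y (suc (suc n)) = begin
      addS (mulS Y (geometricSum Y Y (suc n))) Yⁿ⁺¹  ≈⟨ +-congʳ {Yⁿ⁺¹} (*-congˡ {Y} (geometricSum-diagonal Y (suc n))) ⟩
      addS (mulS Y (suc n × powS Y n)) Yⁿ⁺¹          ≈⟨ +-congʳ {Yⁿ⁺¹} (×-comm-* (suc n) Y (powS Y n)) ⟩
      addS (suc n × Yⁿ⁺¹) Yⁿ⁺¹                       ≈⟨ +-comm (suc n × Yⁿ⁺¹) Yⁿ⁺¹ ⟩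
      suc (suc n) × Yⁿ⁺¹                             ∎
      where Yⁿ⁺¹ = powS Y (suc n)

  -- Xᵖ - Yᵖ = (X - Y)·S with S ≡ p·Yᵖ⁻¹ ≡ 0 (mod p).
  ^p-lift : ∀ p s {X Y} → X ≈ Y mod + (p ℕ.^ suc s) → powS X p ≈ powS Y p mod + (p ℕ.^ suc (suc s))
  ^p-lift p s {X} {Y} X≈Y =
    ≈-trans (powS-difference X Y p) (≈-trans (+-congˡ {powS Y p} [X-Y]S≈0) (+-identityʳ (powS Y p)))
    where
    open CommutativeRing (seriesRing (+ (p ℕ.^ suc (suc s)))) using (+-congˡ; +-identityʳ)
    S≈0 : geometricSum X Y p ≈ zeroS mod + p
    S≈0 = ≈-trans (geometricSum-cong Y p (≈-weaken (∣ᵤ⇒∣ (ℕᵈ.m∣m*n (p ℕ.^ s))) X≈Y))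
            (≈-trans (geometricSum-diagonal Y p) (×-vanishes p _ ∣-refl))
    [X-Y]S≈0 : mulS (addS X (negS Y)) (geometricSum X Y p) ≈ zeroS mod + (p ℕ.^ suc (suc s))
    [X-Y]S≈0 = ∣⇒≈0 λ n → subst (_∣ _) p^[s+1]·p≡p^[s+2]
      (mulS-∣ (addS X (negS Y)) (geometricSum X Y p) (coeff-∣ X≈Y) (≈0⇒∣ S≈0) n)
      where
      p^[s+1]·p≡p^[s+2] : + (p ℕ.^ suc s) * + p ≡ + (p ℕ.^ suc (suc s))
      p^[s+1]·p≡p^[s+2] = trans (sym (ℤₚ.pos-* (p ℕ.^ suc s) p)) (cong +_ (ℕₚ.*-comm (p ℕ.^ suc s) p))

  ^p^s-lift : ∀ p s {X Y} → X ≈ Y mod + p → powS X (p ℕ.^ s) ≈ powS Y (p ℕ.^ s) mod + (p ℕ.^ suc s)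
  ^p^s-lift p zero    {X} {Y} X≈Y =
    ≈-trans (≗⇒≈ (mulS-identityʳ X)) (≈-trans X≈Y′ (≈-sym (≗⇒≈ (mulS-identityʳ Y))))
    where X≈Y′ = subst (X ≈ Y mod_) (cong +_ (sym (ℕₚ.*-identityʳ p))) X≈Y
  ^p^s-lift p (suc s) {X} {Y} X≈Y = begin
    powS X (p ℕ.* p ℕ.^ s)        ≡⟨ cong (powS X) (ℕₚ.*-comm p (p ℕ.^ s)) ⟩
    powS X (p ℕ.^ s ℕ.* p)        ≈⟨ powS-* X (p ℕ.^ s) p ⟨
    powS (powS X (p ℕ.^ s)) p     ≈⟨ ^p-lift p s (^p^s-lift p s X≈Y) ⟩
    powS (powS Y (p ℕ.^ s)) p     ≈⟨ powS-* Y (p ℕ.^ s) p ⟩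
    powS Y (p ℕ.^ s ℕ.* p)        ≡⟨ cong (powS Y) (ℕₚ.*-comm (p ℕ.^ s) p) ⟩
    powS Y (p ℕ.* p ℕ.^ s)        ∎
    where open CommutativeRing (seriesRing (+ (p ℕ.^ suc (suc s)))) using (setoid)
          open import Relation.Binary.Reasoning.Setoid setoid

  -- The Frobenius congruence

  [1+k]*[1+n]C[1+k]≡[1+n]*nCk : ∀ n k → suc k ℕ.* (suc n C suc k) ≡ suc n ℕ.* (n C k)
  [1+k]*[1+n]C[1+k]≡[1+n]*nCk zero    zero    = refl
  [1+k]*[1+n]C[1+k]≡[1+n]*nCk zero    (suc k) = ℕₚ.*-zeroʳ (suc (suc k))
  [1+k]*[1+n]C[1+k]≡[1+n]*nCk (suc n) zero    =
    trans (ℕₚ.*-identityˡ _) (trans (nC1≡n (suc (suc n))) (sym (ℕₚ.*-identityʳ (suc (suc n)))))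
  [1+k]*[1+n]C[1+k]≡[1+n]*nCk (suc n) (suc k) = begin
    suc (suc k) ℕ.* (suc n′ C suc (suc k))
      ≡⟨ cong (suc (suc k) ℕ.*_) (nCk+nC[k+1]≡[n+1]C[k+1] n′ (suc k)) ⟨
    suc (suc k) ℕ.* (a ℕ.+ b)
      ≡⟨ solve 3 (λ k a b → (con 2 :+ k) :* (a :+ b) := a :+ (con 1 :+ k) :* a :+ (con 2 :+ k) :* b) refl k a b ⟩
    a ℕ.+ suc k ℕ.* a ℕ.+ suc (suc k) ℕ.* b
      ≡⟨ cong₂ (λ u v → a ℕ.+ u ℕ.+ v) ([1+k]*[1+n]C[1+k]≡[1+n]*nCk n k) ([1+k]*[1+n]C[1+k]≡[1+n]*nCk n (suc k)) ⟩
    a ℕ.+ n′ ℕ.* c ℕ.+ n′ ℕ.* c′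
      ≡⟨ solve 4 (λ a n c d → a :+ n :* c :+ n :* d := a :+ n :* (c :+ d)) refl a n′ c c′ ⟩
    a ℕ.+ n′ ℕ.* (c ℕ.+ c′)
      ≡⟨ cong (λ z → a ℕ.+ n′ ℕ.* z) (nCk+nC[k+1]≡[n+1]C[k+1] n k) ⟩
    suc n′ ℕ.* a
      ∎
    where
    open ≡-Reasoning
    open import Data.Nat.Solver using (module +-*-Solver)
    open +-*-Solver
    n′ = suc n
    a = n′ C suc k
    b = n′ C suc (suc k)
    c = n C k
    c′ = n C suc k

  prime∣pCk : ∀ {p k} → Prime p → 0 < k → k < p → p ∣ℕ p C k
  prime∣pCk {suc n} {suc k} p-prime _ k<p
    with euclidsLemma (suc k) (suc n C suc k) p-prime
           (ℕᵈ.divides (n C k) (trans ([1+k]*[1+n]C[1+k]≡[1+n]*nCk n k) (ℕₚ.*-comm (suc n) (n C k))))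
  ... | inj₂ p∣pCk = p∣pCk
  ... | inj₁ p∣1+k = contradiction (ℕᵈ.∣⇒≤ p∣1+k) (ℕₚ.<⇒≱ k<p)

  module _ {m : ℤ} where
    open CommutativeRing (seriesRing m)
      using ( setoid; semiring; commutativeSemiring; +-monoid; +-cong; +-congˡ; +-comm
            ; +-identityˡ; +-identityʳ; *-identityˡ; *-identityʳ)
    open import Algebra.Properties.CommutativeSemiring.Binomial commutativeSemiring
      using (binomialExpansion; binomialTerm; theorem)
    open import Algebra.Properties.Semiring.Exp semiring using (_^_)
    open import Algebra.Properties.Monoid.Sum +-monoid
      using (sum; sum-init-last; sum-cong-≋; sum-replicate-zero)
    open import Relation.Binary.Reasoning.Setoid setoid

    binomialExpansion-middle-vanishes : ∀ n x y → (∀ k → 0 < k → k < suc n → m ∣ + (suc n C k)) →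
      binomialExpansion x y (suc n) ≈ addS (x ^ suc n) (y ^ suc n) mod m
    binomialExpansion-middle-vanishes n x y m∣C = begin
      sum t                                                      ≈⟨ +-congˡ {t zero} (sum-init-last (t ∘ suc)) ⟩
      addS (t zero) (addS (sum (t ∘ suc ∘ inject₁)) (t (suc (fromℕ n))))
                                                                 ≈⟨ +-cong first (+-cong middle last) ⟩
      addS (y ^ suc n) (addS zeroS (x ^ suc n))                  ≈⟨ +-congˡ {y ^ suc n} (+-identityˡ (x ^ suc n)) ⟩
      addS (y ^ suc n) (x ^ suc n)                               ≈⟨ +-comm (y ^ suc n) (x ^ suc n) ⟩
      addS (x ^ suc n) (y ^ suc n)                               ∎
      where
      t = binomialTerm x y (suc n)
      first : t zero ≈ y ^ suc n mod m
      first = ≈-trans (+-identityʳ _) (*-identityˡ (y ^ suc n))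
      last : t (suc (fromℕ n)) ≈ x ^ suc n mod m
      last rewrite Finₚ.toℕ-fromℕ n | nCn≡1 (suc n) | ℕₚ.n∸n≡0 n =
        ≈-trans (+-identityʳ _) (*-identityʳ (x ^ suc n))
      middle : sum (t ∘ suc ∘ inject₁) ≈ zeroS mod m
      middle = ≈-trans (sum-cong-≋ (λ i → ×-vanishes _ _ (m∣C _ (s≤s z≤n) (toℕ-inject₁<n i))))
                       (sum-replicate-zero n)
        where
        toℕ-inject₁<n : ∀ i → suc (toℕ (inject₁ i)) < suc n
        toℕ-inject₁<n i = s≤s (subst (_< n) (sym (Finₚ.toℕ-inject₁ i)) (Finₚ.toℕ<n i))

    freshman's-dream : ∀ n x y → 0 < n → (∀ k → 0 < k → k < n → m ∣ + (n C k)) →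
      powS (addS x y) n ≈ addS (powS x n) (powS y n) mod m
    freshman's-dream (suc n) x y _ m∣C = begin
      powS (addS x y) (suc n)                ≈⟨ powS≈^ (addS x y) (suc n) ⟩
      addS x y ^ suc n                       ≈⟨ theorem (suc n) x y ⟩
      binomialExpansion x y (suc n)          ≈⟨ binomialExpansion-middle-vanishes n x y m∣C ⟩
      addS (x ^ suc n) (y ^ suc n)           ≈⟨ +-cong (powS≈^ x (suc n)) (powS≈^ y (suc n)) ⟨
      addS (powS x (suc n)) (powS y (suc n)) ∎

  frobenius : ∀ {p} → Prime p → ∀ x y → powS (addS x y) p ≈ addS (powS x p) (powS y p) mod + p
  frobenius {p} p-prime x y = freshman's-dream p x y (ℕ.>-nonZero⁻¹ p {{prime⇒nonZero p-prime}})
    (λ k 0<k k<p → ∣ᵤ⇒∣ (prime∣pCk p-prime 0<k k<p))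

  -- Series in q^e

  shift : ℕ → Series → Series
  shift zero    X         = X
  shift (suc a) X zero    = + 0
  shift (suc a) X (suc n) = shift a X n

  shift-cong : ∀ a {X Y} → X ≗ Y → shift a X ≗ shift a Y
  shift-cong zero    X≗Y n       = X≗Y n
  shift-cong (suc a) X≗Y zero    = refl
  shift-cong (suc a) X≗Y (suc n) = shift-cong a X≗Y n

  shift-+ : ∀ a b X → shift a (shift b X) ≗ shift (a ℕ.+ b) X
  shift-+ zero    b X n       = refl
  shift-+ (suc a) b X zero    = refl
  shift-+ (suc a) b X (suc n) = shift-+ a b X n

  shift-< : ∀ a X {n} → n < a → shift a X n ≡ + 0
  shift-< (suc a) X {zero}  _         = refl
  shift-< (suc a) X {suc n} (s≤s n<a) = shift-< a X n<a

  shift-≥ : ∀ a X {n} → a ≤ n → shift a X n ≡ X (n ∸ a)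
  shift-≥ zero    X         _         = refl
  shift-≥ (suc a) X {suc n} (s≤s a≤n) = shift-≥ a X a≤n

  mulS-shiftˡ : ∀ a X Y → mulS (shift a X) Y ≗ shift a (mulS X Y)
  mulS-shiftˡ zero    X Y n       = refl
  mulS-shiftˡ (suc a) X Y zero    = ℤₚ.*-zeroˡ (Y 0)
  mulS-shiftˡ (suc a) X Y (suc n) = begin
    mulS (shift (suc a) X) Y (suc n)              ≡⟨ mulS-suc (shift (suc a) X) Y n ⟩
    + 0 * Y (suc n) + mulS (shift a X) Y n        ≡⟨ cong (_+ mulS (shift a X) Y n) (ℤₚ.*-zeroˡ (Y (suc n))) ⟩
    + 0 + mulS (shift a X) Y n                    ≡⟨ ℤₚ.+-identityˡ _ ⟩
    mulS (shift a X) Y n                          ≡⟨ mulS-shiftˡ a X Y n ⟩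
    shift a (mulS X Y) n                          ∎
    where open ≡-Reasoning

  powS-shift : ∀ a X k → powS (shift a X) k ≗ shift (k ℕ.* a) (powS X k)
  powS-shift a X zero    n = refl
  powS-shift a X (suc k) n = begin
    mulS (shift a X) (powS (shift a X) k) n         ≡⟨ mulS-cong {shift a X} (λ _ → refl) (powS-shift a X k) n ⟩
    mulS (shift a X) (shift ka (powS X k)) n        ≡⟨ mulS-shiftˡ a X (shift ka (powS X k)) n ⟩
    shift a (mulS X (shift ka (powS X k))) n        ≡⟨ shift-cong a shift-commutes n ⟩
    shift a (shift ka (powS X (suc k))) n           ≡⟨ shift-+ a ka _ n ⟩
    shift (suc k ℕ.* a) (powS X (suc k)) n          ∎
    where
    open ≡-Reasoning
    ka = k ℕ.* a
    shift-commutes : mulS X (shift ka (powS X k)) ≗ shift ka (powS X (suc k))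
    shift-commutes i = trans (mulS-comm X (shift ka (powS X k)) i)
      (trans (mulS-shiftˡ ka (powS X k) X i) (shift-cong ka (mulS-comm (powS X k) X) i))

  IsSeriesInQ^ : ℕ → Series → Set
  IsSeriesInQ^ e Z = ∀ n → ¬ e ∣ℕ n → Z n ≡ + 0

  constant : ℤ → Series
  constant c zero    = c
  constant c (suc _) = + 0

  constant-in : ∀ e c → IsSeriesInQ^ e (constant c)
  constant-in e c zero    e∤0 = contradiction (e ℕᵈ.∣0) e∤0
  constant-in e c (suc n) _   = refl

  oneS-in : ∀ e → IsSeriesInQ^ e oneS
  oneS-in e zero    e∤0 = contradiction (e ℕᵈ.∣0) e∤0
  oneS-in e (suc n) _   = refl

  isSeriesInQ^1 : ∀ Z → IsSeriesInQ^ 1 Z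
  isSeriesInQ^1 Z n 1∤n = contradiction (ℕᵈ.1∣ n) 1∤n

  mulS-in : ∀ e {X Y} → IsSeriesInQ^ e X → IsSeriesInQ^ e Y → IsSeriesInQ^ e (mulS X Y)
  mulS-in e {X} {Y} X∈ Y∈ n e∤n = sumTo-zero n term
    where
    term : ∀ i → i ≤ n → X i * Y (n ∸ i) ≡ + 0
    term i i≤n with e ℕᵈ.∣? i
    ... | no  e∤i = trans (cong (_* Y (n ∸ i)) (X∈ i e∤i)) (ℤₚ.*-zeroˡ (Y (n ∸ i)))
    ... | yes e∣i = trans (cong (X i *_) (Y∈ (n ∸ i) e∤n∸i)) (ℤₚ.*-zeroʳ (X i))
      where
      e∤n∸i : ¬ e ∣ℕ n ∸ i
      e∤n∸i e∣n∸i = e∤n (subst (e ∣ℕ_) (ℕₚ.m+[n∸m]≡n i≤n) (ℕᵈ.∣m∣n⇒∣m+n e∣i e∣n∸i))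

  powS-in : ∀ e {X} → IsSeriesInQ^ e X → ∀ k → IsSeriesInQ^ e (powS X k)
  powS-in e X∈ zero    = oneS-in e
  powS-in e X∈ (suc k) = mulS-in e X∈ (powS-in e X∈ k)

  restrict : ℕ → Series → Series
  restrict e X n with e ℕᵈ.∣? n
  ... | yes _ = X n
  ... | no  _ = + 0

  restrict-in : ∀ e X → IsSeriesInQ^ e (restrict e X)
  restrict-in e X n e∤n with e ℕᵈ.∣? n
  ... | yes e∣n = contradiction e∣n e∤n
  ... | no  _   = refl

  drop : ℕ → Series → Series
  drop a Z k = Z (a ℕ.+ k)

  drop-in : ∀ e {Z} → IsSeriesInQ^ e Z → IsSeriesInQ^ e (drop e Z)
  drop-in e Z∈ n e∤n = Z∈ (e ℕ.+ n) (λ e∣e+n → e∤n (ℕᵈ.∣m+n∣m⇒∣n e∣e+n ℕᵈ.∣-refl))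

  decompose : ∀ {e Z} → 0 < e → IsSeriesInQ^ e Z → Z ≗ addS (constant (Z 0)) (shift e (drop e Z))
  decompose {e} {Z} 0<e Z∈ zero =
    sym (trans (cong (_+_ (Z 0)) (shift-< e (drop e Z) 0<e)) (ℤₚ.+-identityʳ (Z 0)))
  decompose {e} {Z} 0<e Z∈ (suc n) with suc n ℕₚ.<? e
  ... | yes n<e = trans (Z∈ (suc n) (λ e∣n → ℕₚ.<⇒≱ n<e (ℕᵈ.∣⇒≤ e∣n)))
                        (sym (trans (ℤₚ.+-identityˡ _) (shift-< e (drop e Z) n<e)))
  ... | no  n≮e = sym (trans (ℤₚ.+-identityˡ _)
                        (trans (shift-≥ e (drop e Z) e≤n) (cong Z (ℕₚ.m+[n∸m]≡n e≤n))))
    where e≤n = ℕₚ.≮⇒≥ n≮e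

  module _ {p} (p-prime : Prime p) where
    private instance
      p≢0 : NonZero p
      p≢0 = prime⇒nonZero p-prime

    -- Writing Z = Z₀ + q^{pᵉ}T, Frobenius gives Zᵖ ≡ Z₀ᵖ + q^{pᵉ⁺¹}Tᵖ (mod p), and T is again a
    -- series in q^{pᵉ}, so induction on the coefficient index applies to Tᵖ.
    powS-prime-coeff-∣ : ∀ e n Z → IsSeriesInQ^ (p ℕ.^ e) Z → ¬ p ℕ.^ suc e ∣ℕ n → + p ∣ powS Z p n
    powS-prime-coeff-∣ e = <-rec P step
      where
      P : ℕ → Set
      P n = ∀ Z → IsSeriesInQ^ (p ℕ.^ e) Z → ¬ p ℕ.^ suc e ∣ℕ n → + p ∣ powS Z p n
      step : ∀ n → (∀ {k} → k < n → P k) → P n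
      step zero    _   Z _  ∤0 = contradiction (ℕᵈ._∣0 _) ∤0
      step (suc n) rec Z Z∈ ∤n = ≈-coeff-∣ Zᵖ≈ (suc n) (∣m∣n⇒∣m+n constant-part shifted-part)
        where
        E = p ℕ.^ e
        Z₀ = constant (Z 0)
        T = drop E Z
        Zᵖ≈ : powS Z p ≈ addS (powS Z₀ p) (shift (p ℕ.* E) (powS T p)) mod + p
        Zᵖ≈ = ≈-trans (powS-cong p (≗⇒≈ (decompose (ℕₚ.m^n>0 p e) Z∈)))
                (≈-trans (frobenius p-prime Z₀ (shift E T))
                         (addS-cong (≈-refl {a = powS Z₀ p}) (≗⇒≈ (powS-shift E T p))))
        constant-part : + p ∣ powS Z₀ p (suc n)
        constant-part = subst (_ ∣_) (sym (powS-in _ (constant-in _ (Z 0)) p (suc n) ∤n)) ∣0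
        shifted-part : + p ∣ shift (p ℕ.* E) (powS T p) (suc n)
        shifted-part with suc n ℕₚ.<? p ℕ.* E
        ... | yes n<pE = subst (_ ∣_) (sym (shift-< _ _ n<pE)) ∣0
        ... | no  n≮pE = subst (_ ∣_) (sym (shift-≥ _ _ pE≤n)) (rec smaller T (drop-in E Z∈) ∤n∸pE)
          where
          pE≤n = ℕₚ.≮⇒≥ n≮pE
          smaller : suc n ∸ p ℕ.* E < suc n
          smaller = ℕₚ.∸-monoʳ-< (ℕₚ.m^n>0 p (suc e)) pE≤n
          ∤n∸pE : ¬ p ℕ.^ suc e ∣ℕ suc n ∸ p ℕ.* E
          ∤n∸pE ∣n∸pE = ∤n (subst (p ℕ.* E ∣ℕ_) (ℕₚ.m+[n∸m]≡n pE≤n) (ℕᵈ.∣m∣n⇒∣m+n ℕᵈ.∣-refl ∣n∸pE))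

    powS-prime-≈-restrict : ∀ e {Z} → IsSeriesInQ^ (p ℕ.^ e) Z →
      powS Z p ≈ restrict (p ℕ.^ suc e) (powS Z p) mod + p
    powS-prime-≈-restrict e {Z} Z∈ = coeffwise coeff
      where
      coeff : ∀ n → + p ∣ powS Z p n - restrict (p ℕ.^ suc e) (powS Z p) n
      coeff n with p ℕ.^ suc e ℕᵈ.∣? n
      ... | yes _ = subst (_ ∣_) (sym (ℤₚ.+-inverseʳ (powS Z p n))) ∣0
      ... | no ∤n = subst (_ ∣_) (sym (ℤₚ.+-identityʳ _)) (powS-prime-coeff-∣ e n Z Z∈ ∤n)

  frobeniusIterate : ℕ → ℕ → Series → Series
  frobeniusIterate p zero    Z = Z
  frobeniusIterate p (suc i) Z = restrict (p ℕ.^ suc i) (powS (frobeniusIterate p i Z) p)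

  frobeniusIterate-in : ∀ p i Z → IsSeriesInQ^ (p ℕ.^ i) (frobeniusIterate p i Z)
  frobeniusIterate-in p zero    Z = isSeriesInQ^1 Z
  frobeniusIterate-in p (suc i) Z = restrict-in _ _

  powS-frobeniusIterate : ∀ {p} → Prime p → ∀ i s Z →
    powS Z (p ℕ.^ (i ℕ.+ s)) ≈ powS (frobeniusIterate p i Z) (p ℕ.^ s) mod + (p ℕ.^ suc s)
  powS-frobeniusIterate         p-prime zero    s Z = ≈-refl
  powS-frobeniusIterate {p = p} p-prime (suc i) s Z = begin
    powS Z (p ℕ.^ (suc i ℕ.+ s))
      ≡⟨ cong (λ t → powS Z (p ℕ.^ t)) (sym (ℕₚ.+-suc i s)) ⟩
    powS Z (p ℕ.^ (i ℕ.+ suc s))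
      ≈⟨ ≈-weaken (∣ᵤ⇒∣ (ℕᵈ.n∣m*n p)) (powS-frobeniusIterate p-prime i (suc s) Z) ⟩
    powS R (p ℕ.* p ℕ.^ s)
      ≈⟨ powS-* R p (p ℕ.^ s) ⟨
    powS (powS R p) (p ℕ.^ s)
      ≈⟨ ^p^s-lift p s (powS-prime-≈-restrict p-prime i (frobeniusIterate-in p i Z)) ⟩
    powS (frobeniusIterate p (suc i) Z) (p ℕ.^ s)
      ∎
    where
    R = frobeniusIterate p i Z
    open CommutativeRing (seriesRing (+ (p ℕ.^ suc s))) using (setoid)
    open import Relation.Binary.Reasoning.Setoid setoid

  -- The generating functions of d_k

  f₂/f₁³ : Series
  f₂/f₁³ = mulS (f 2) (powS f1inv 3)

  d[A+k]≈d[k]*[f₂/f₁³]^A : ∀ {m} A k → d (A ℕ.+ k) ≈ mulS (d k) (powS f₂/f₁³ A) mod m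
  d[A+k]≈d[k]*[f₂/f₁³]^A {m} A k = begin
    mulS (powS (f 2) (A ℕ.+ k)) (powS f1inv (suc (3 ℕ.* (A ℕ.+ k))))
      ≈⟨ mulS-cong-≈ (powS-+ (f 2) A k) (≈-trans (≗⇒≈ (λ n → cong (λ e → powS f1inv e n) exponent))
                                                 (powS-+ f1inv (3 ℕ.* A) (suc (3 ℕ.* k)))) ⟩
    mulS (mulS f₂ᴬ f₂ᵏ) (mulS (powS f1inv (3 ℕ.* A)) f₁⁻ᵏ)
      ≈⟨ *-congˡ {mulS f₂ᴬ f₂ᵏ} (*-congʳ {f₁⁻ᵏ} (powS-* f1inv 3 A)) ⟨
    mulS (mulS f₂ᴬ f₂ᵏ) (mulS f₁⁻³ᴬ f₁⁻ᵏ)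
      ≈⟨ solve 4 (λ a b c e → (a :* b) :* (c :* e) := (b :* e) :* (a :* c)) ≈-refl f₂ᴬ f₂ᵏ f₁⁻³ᴬ f₁⁻ᵏ ⟩
    mulS (d k) (mulS f₂ᴬ f₁⁻³ᴬ)
      ≈⟨ *-congˡ {d k} (powS-distrib (f 2) (powS f1inv 3) A) ⟨
    mulS (d k) (powS f₂/f₁³ A)
      ∎
    where
    open CommutativeRing (seriesRing m) using (setoid; commutativeSemiring; *-congˡ; *-congʳ)
    open import Relation.Binary.Reasoning.Setoid setoid
    open import Algebra.Solver.Ring.NaturalCoefficients.Default commutativeSemiring
    f₂ᴬ = powS (f 2) A
    f₂ᵏ = powS (f 2) k
    f₁⁻³ᴬ = powS (powS f1inv 3) A
    f₁⁻ᵏ = powS f1inv (suc (3 ℕ.* k))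
    exponent : suc (3 ℕ.* (A ℕ.+ k)) ≡ 3 ℕ.* A ℕ.+ suc (3 ℕ.* k)
    exponent = trans (cong suc (ℕₚ.*-distribˡ-+ 3 A k)) (sym (ℕₚ.+-suc (3 ℕ.* A) (3 ℕ.* k)))

  i+tQ≡Qn+r⇒i≡Qq+r : ∀ {Q r i t n} → r < Q → i ℕ.+ t ℕ.* Q ≡ Q ℕ.* n ℕ.+ r → ∃[ q ] i ≡ Q ℕ.* q ℕ.+ r
  i+tQ≡Qn+r⇒i≡Qq+r {Q} {r} {i} {t} {n} r<Q eq = i / Q , (begin
    i                        ≡⟨ m≡m%n+[m/n]*n i Q ⟩
    i % Q ℕ.+ i / Q ℕ.* Q    ≡⟨ cong (ℕ._+ i / Q ℕ.* Q) i%Q≡r ⟩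
    r ℕ.+ i / Q ℕ.* Q        ≡⟨ ℕₚ.+-comm r _ ⟩
    i / Q ℕ.* Q ℕ.+ r        ≡⟨ cong (ℕ._+ r) (ℕₚ.*-comm (i / Q) Q) ⟩
    Q ℕ.* (i / Q) ℕ.+ r      ∎)
    where
    open ≡-Reasoning
    instance
      Q≢0 : NonZero Q
      Q≢0 = ℕ.>-nonZero (ℕₚ.≤-<-trans z≤n r<Q)
    Qn+r≡r+nQ : Q ℕ.* n ℕ.+ r ≡ r ℕ.+ n ℕ.* Q
    Qn+r≡r+nQ = trans (ℕₚ.+-comm (Q ℕ.* n) r) (cong (r ℕ.+_) (ℕₚ.*-comm Q n))
    i%Q≡r : i % Q ≡ r
    i%Q≡r = begin
      i % Q                        ≡⟨ [m+kn]%n≡m%n i t Q ⟨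
      (i ℕ.+ t ℕ.* Q) % Q          ≡⟨ cong (_% Q) (trans eq Qn+r≡r+nQ) ⟩
      (r ℕ.+ n ℕ.* Q) % Q          ≡⟨ [m+kn]%n≡m%n r n Q ⟩
      r % Q                        ≡⟨ m<n⇒m%n≡m r<Q ⟩
      r                            ∎

  -- Only the terms Dᵢ H_{Qn+r-i} with Q ∣ Qn+r-i survive, and those have i ≡ r (mod Q).
  mulS-residue-∣ : ∀ {m : ℤ} {Q r} D H → r < Q → IsSeriesInQ^ Q H →
    (∀ n → m ∣ D (Q ℕ.* n ℕ.+ r)) → ∀ n → m ∣ mulS D H (Q ℕ.* n ℕ.+ r)
  mulS-residue-∣ {m} {Q} {r} D H r<Q H∈ m∣D n = ∣-sumTo N term
    where
    N = Q ℕ.* n ℕ.+ r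
    term : ∀ i → i ≤ N → m ∣ D i * H (N ∸ i)
    term i i≤N with Q ℕᵈ.∣? (N ∸ i)
    ... | no  Q∤N∸i = subst (_ ∣_) (sym (trans (cong (D i *_) (H∈ (N ∸ i) Q∤N∸i)) (ℤₚ.*-zeroʳ (D i)))) ∣0
    ... | yes (ℕᵈ.divides t N∸i≡tQ)
      with i+tQ≡Qn+r⇒i≡Qq+r {t = t} {n} r<Q (trans (cong (i ℕ.+_) (sym N∸i≡tQ)) (ℕₚ.m+[n∸m]≡n i≤N))
    ...   | q , i≡Qq+r = ∣m⇒∣m*n (H (N ∸ i)) (subst (λ j → m ∣ D j) (sym i≡Qq+r) (m∣D q))

open import Data.Nat using (ℕ; _+_; _*_; _^_; _∸_; _≤_; _<_)
import Data.Nat.Properties as ℕₚ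
open import Data.Nat.Primality using (Prime)
open import Data.Integer using (+_)
open import Data.Integer.Divisibility using (_∣_)
open import Data.Integer.Divisibility.Signed using (∣ᵤ⇒∣; ∣⇒∣ᵤ)
open import Function using (_∘_)
open import Relation.Binary.PropositionalEquality using (sym; subst₂)

theorem5p1 : (p : ℕ) → Prime p → (k j N M r : ℕ) →
    1 ≤ k → 1 ≤ N → 1 ≤ M → 1 ≤ r → r < p ^ M →
    (∀ n → (+ (p ^ N)) ∣ d k (p ^ M * n + r)) →
    ∀ n → (+ (p ^ N)) ∣ d (p ^ (M + N ∸ 1) * j + k) (p ^ M * n + r)
theorem5p1 p p-prime k j N M r _ 1≤N _ _ r<p^M p^N∣d[k] n =
  ∣⇒∣ᵤ (≈-coeff-∣ d[Pj+k]≈d[k]*H (p ^ M * n + r) (mulS-residue-∣ (d k) H r<p^M H∈ (∣ᵤ⇒∣ ∘ p^N∣d[k]) n))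
  where
  P = p ^ (M + N ∸ 1)
  W = frobeniusIterate p M f₂/f₁³
  H = powS (powS W (p ^ (N ∸ 1))) j
  H∈ : IsSeriesInQ^ (p ^ M) H
  H∈ = powS-in _ (powS-in _ (frobeniusIterate-in p M f₂/f₁³) (p ^ (N ∸ 1))) j
  Gᴾ≈W^p^[N-1] : powS f₂/f₁³ P ≈ powS W (p ^ (N ∸ 1)) mod + (p ^ N)
  Gᴾ≈W^p^[N-1] = subst₂ (λ a b → powS f₂/f₁³ (p ^ a) ≈ powS W (p ^ (N ∸ 1)) mod + (p ^ b))
    (sym (ℕₚ.+-∸-assoc M 1≤N)) (ℕₚ.m+[n∸m]≡n 1≤N) (powS-frobeniusIterate p-prime M (N ∸ 1) f₂/f₁³)
  d[Pj+k]≈d[k]*H : d (P * j + k) ≈ mulS (d k) H mod + (p ^ N)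
  d[Pj+k]≈d[k]*H = ≈-trans (d[A+k]≈d[k]*[f₂/f₁³]^A (P * j) k)
    (mulS-cong-≈ (≈-refl {a = d k}) (≈-trans (≈-sym (powS-* f₂/f₁³ P j)) (powS-cong j Gᴾ≈W^p^[N-1])))
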